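{- Let $\mathcal{O}=\mathbb{Z}[i]$. Let $\alpha,\beta,\gamma,\delta\in\mathcal{O}$ with $\alpha,\beta$ coprime, $\alpha\gamma-\beta\delta=1$, $|\gamma|\le|\beta|$ and $|\delta|\le|\alpha|$. Let $k\in\mathcal{O}$ with $|k|^2=2$, i.e. $k\in\{1+i,1-i,-1+i,-1-i\}$, and write $k=k_1+k_2 i$ with $k_1,k_2\in\mathbb{Z}$. If \[ |\delta+k\alpha|^2+|\gamma+k\beta|^2\le|\alpha|^2+|\beta|^2, \] then at least one of $|\delta+k_1\alpha|^2+|\gamma+k_1\beta|^2$ and $|\delta+k_2 i\,\alpha|^2+|\gamma+k_2 i\,\beta|^2$ is strictly less than $|\alpha|^2+|\beta|^2$.
   Context: $|\cdot|$ denotes the usual complex absolute value. -}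

module Defs where

open import Data.Integer using (ℤ; +_; _+_; _*_; _-_; -_)
open import Data.Product using (∃)
open import Relation.Binary.PropositionalEquality using (_≡_)

record 𝔾 : Set where
  constructor _+_i
  field
    re : ℤ
    im : ℤ
open 𝔾 public

infixl 6 _⊕_ _⊖_
infixl 7 _⊗_

_⊕_ : 𝔾 → 𝔾 → 𝔾
(a + b i) ⊕ (c + d i) = (a + c) + (b + d) i

_⊖_ : 𝔾 → 𝔾 → 𝔾
(a + b i) ⊖ (c + d i) = (a - c) + (b - d) i

_⊗_ : 𝔾 → 𝔾 → 𝔾
(a + b i) ⊗ (c + d i) = (a * c - b * d) + (a * d + b * c) i

ofℤ : ℤ → 𝔾
ofℤ n = n + (+ 0) i

ofℤi : ℤ → 𝔾
ofℤi n = (+ 0) + n i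

𝟙 : 𝔾
𝟙 = ofℤ (+ 1)

normSq : 𝔾 → ℤ
normSq (a + b i) = a * a + b * b

_∣𝔾_ : 𝔾 → 𝔾 → Set
d ∣𝔾 a = ∃ λ e → d ⊗ e ≡ a

IsUnit : 𝔾 → Set
IsUnit u = ∃ λ v → u ⊗ v ≡ 𝟙

Coprime𝔾 : 𝔾 → 𝔾 → Set
Coprime𝔾 α β = ∀ d → d ∣𝔾 α → d ∣𝔾 β → IsUnit d

-- Put N = |α|² + |β|², S = |δ|² + |γ|², w = ᾱδ + β̄γ and E(t) = |δ + tα|² + |γ + tβ|².
-- Then E(t) = S + 2⟨w, t⟩ + |t|² N with ⟨w, t⟩ real-linear in t, and k₁² = k₂² = 1, so
-- E(k₁) + E(k₂ i) = E(k) + S ≤ 2N. Both shifts can fail only if E(k₁) = E(k₂ i) = S = N;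
-- then S = -2k₁ Re w = -2k₂ Im w, so S² = 4 (Re w)² = 4 (Im w)², while Lagrange's identity
-- |w|² + |αγ - βδ|² = N S reads |w|² + 1 = S². Together 2 S² = 4, i.e. 1 = 2 (Re w)².
module Submission where

open import Defs
open import Data.Integer using (ℤ; +_; _+_; _≤_; _<_)
open import Data.Sum using (_⊎_)
open import Relation.Binary.PropositionalEquality using (_≡_)

open import Data.Integer using (_*_; _-_; -_; ∣_∣; -[1+_])
open import Data.Integer.Properties
  using (_<?_; ≮⇒≥; ≤⇒≯; ≤∧≢⇒<; +-mono-≤; +-mono-<-≤; +-comm
        ; +-identityˡ; +-identityʳ; *-identityˡ; *-identityʳ; *-zeroʳ; *-cancelˡ-≡; abs-*; +◃n≡+n
        ; +-0-abelianGroup)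
  renaming (_≟_ to _≟ℤ_)
open import Algebra.Properties.AbelianGroup +-0-abelianGroup using (∙-cancelʳ)
open import Data.Integer.Tactic.RingSolver using (solve-∀)
import Data.Nat as ℕ
import Data.Nat.Properties as ℕ
open import Data.Sum using (inj₁; inj₂)
import Data.Sum as Sum
open import Data.Empty using (⊥-elim)
open import Relation.Nullary using (yes; no)
open import Relation.Binary.PropositionalEquality
  using (_≢_; refl; sym; trans; cong; cong₂; subst; subst₂; module ≡-Reasoning)
open ≡-Reasoning

+1≢+2* : ∀ x → + 1 ≢ + 2 * x
+1≢+2* x eq = ℕ.even≢odd ∣ x ∣ 0 (sym (trans (cong ∣_∣ eq) (abs-* (+ 2) x)))

x*x≡+∣x∣*∣x∣ : ∀ x → x * x ≡ + (∣ x ∣ ℕ.* ∣ x ∣)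
x*x≡+∣x∣*∣x∣ (+ n)    = +◃n≡+n (n ℕ.* n)
x*x≡+∣x∣*∣x∣ -[1+ n ] = refl

m*m+n*n≡2⇒m*m≡1 : ∀ m n → m ℕ.* m ℕ.+ n ℕ.* n ≡ 2 → m ℕ.* m ≡ 1
m*m+n*n≡2⇒m*m≡1 0                         0                         ()
m*m+n*n≡2⇒m*m≡1 0                         1                         ()
m*m+n*n≡2⇒m*m≡1 0                         2                         ()
m*m+n*n≡2⇒m*m≡1 0                         (ℕ.suc (ℕ.suc (ℕ.suc _))) ()
m*m+n*n≡2⇒m*m≡1 1                         _                         _ = refl
m*m+n*n≡2⇒m*m≡1 2                         _                         ()
m*m+n*n≡2⇒m*m≡1 (ℕ.suc (ℕ.suc (ℕ.suc _))) _                         ()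

x*x+y*y≡2⇒x*x≡1 : ∀ x y → x * x + y * y ≡ + 2 → x * x ≡ + 1
x*x+y*y≡2⇒x*x≡1 x y eq =
  trans (x*x≡+∣x∣*∣x∣ x) (cong +_ (m*m+n*n≡2⇒m*m≡1 ∣ x ∣ ∣ y ∣ (cong ∣_∣ ∣x∣²+∣y∣²≡2)))
  where
  ∣x∣²+∣y∣²≡2 : + (∣ x ∣ ℕ.* ∣ x ∣ ℕ.+ ∣ y ∣ ℕ.* ∣ y ∣) ≡ + 2
  ∣x∣²+∣y∣²≡2 = trans (sym (cong₂ _+_ (x*x≡+∣x∣*∣x∣ x) (x*x≡+∣x∣*∣x∣ y))) eq

*-unit-square : ∀ {u} x → u * u ≡ + 1 → (x * u) * (x * u) ≡ x * x
*-unit-square {u} x u*u≡1 = begin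
  (x * u) * (x * u) ≡⟨ regroup x u ⟩
  x * x * (u * u)   ≡⟨ cong (x * x *_) u*u≡1 ⟩
  x * x * + 1       ≡⟨ *-identityʳ (x * x) ⟩
  x * x             ∎
  where
  regroup : ∀ x u → (x * u) * (x * u) ≡ x * x * (u * u)
  regroup = solve-∀

+-mono-≤-tightˡ : ∀ {a b c d} → a ≤ b → c ≤ d → b + d ≤ a + c → a ≡ b
+-mono-≤-tightˡ {a} {b} a≤b c≤d b+d≤a+c with a ≟ℤ b
... | yes a≡b = a≡b
... | no a≢b  = ⊥-elim (≤⇒≯ b+d≤a+c (+-mono-<-≤ (≤∧≢⇒< a≤b a≢b) c≤d))

+-mono-≤-tightʳ : ∀ {a b c d} → a ≤ b → c ≤ d → b + d ≤ a + c → c ≡ d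
+-mono-≤-tightʳ {a} {b} {c} {d} a≤b c≤d b+d≤a+c =
  +-mono-≤-tightˡ c≤d a≤b (subst₂ _≤_ (+-comm b d) (+-comm a c) b+d≤a+c)

x+y≡y⇒x≡0 : ∀ x y → x + y ≡ y → x ≡ + 0
x+y≡y⇒x≡0 x y eq = ∙-cancelʳ y x (+ 0) (trans eq (sym (+-identityˡ y)))

x+2y≡0⇒x*x≡4*y*y : ∀ x y → x + + 2 * y ≡ + 0 → x * x ≡ + 4 * (y * y)
x+2y≡0⇒x*x≡4*y*y x y eq = begin
  x * x                                          ≡⟨ difference-of-squares x y ⟩
  (x + + 2 * y) * (x - + 2 * y) + + 4 * (y * y)
    ≡⟨ cong (λ z → z * (x - + 2 * y) + + 4 * (y * y)) eq ⟩
  + 0 * (x - + 2 * y) + + 4 * (y * y)            ≡⟨ +-identityˡ (+ 4 * (y * y)) ⟩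
  + 4 * (y * y)                                  ∎
  where
  difference-of-squares : ∀ x y → x * x ≡ (x + + 2 * y) * (x - + 2 * y) + + 4 * (y * y)
  difference-of-squares = solve-∀

x+2y≡0∧x+2z≡0⇒y*y+z*z+1≢x*x : ∀ x y z → x + + 2 * y ≡ + 0 → x + + 2 * z ≡ + 0
  → y * y + z * z + + 1 ≢ x * x
x+2y≡0∧x+2z≡0⇒y*y+z*z+1≢x*x x y z tie-y tie-z y*y+z*z+1≡x*x =
  +1≢+2* (y * y) (*-cancelˡ-≡ (+ 4) (+ 1) (+ 2 * (y * y)) (begin
    + 4 * + 1                                              ≡⟨ expand y z ⟩
    + 4 * (y * y + z * z + + 1) - + 4 * (y * y) - + 4 * (z * z)
      ≡⟨ cong₂ (λ a b → a - b - + 4 * (z * z)) (cong (+ 4 *_) y*y+z*z+1≡x*x) (sym x*x≡4y*y) ⟩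
    + 4 * (x * x) - x * x - + 4 * (z * z)
      ≡⟨ cong (λ c → + 4 * (x * x) - x * x - c) (sym x*x≡4z*z) ⟩
    + 4 * (x * x) - x * x - x * x                          ≡⟨ collect x ⟩
    + 2 * (x * x)                                          ≡⟨ cong (+ 2 *_) x*x≡4y*y ⟩
    + 2 * (+ 4 * (y * y))                                  ≡⟨ reassociate y ⟩
    + 4 * (+ 2 * (y * y))                                  ∎))
  where
  x*x≡4y*y : x * x ≡ + 4 * (y * y)
  x*x≡4y*y = x+2y≡0⇒x*x≡4*y*y x y tie-y
  x*x≡4z*z : x * x ≡ + 4 * (z * z)
  x*x≡4z*z = x+2y≡0⇒x*x≡4*y*y x z tie-z
  expand : ∀ y z → + 4 * + 1 ≡ + 4 * (y * y + z * z + + 1) - + 4 * (y * y) - + 4 * (z * z)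
  expand = solve-∀
  collect : ∀ x → + 4 * (x * x) - x * x - x * x ≡ + 2 * (x * x)
  collect = solve-∀
  reassociate : ∀ y → + 2 * (+ 4 * (y * y)) ≡ + 4 * (+ 2 * (y * y))
  reassociate = solve-∀

shift-dichotomy : ∀ {S N x y} → S ≤ N → x * x + y * y + + 1 ≡ N * S
  → S + + 2 * (x + y) + + 2 * N ≤ N
  → S + + 2 * x + N < N ⊎ S + + 2 * y + N < N
shift-dichotomy {S} {N} {x} {y} S≤N x*x+y*y+1≡N*S E≤N
  with S + + 2 * x + N <? N | S + + 2 * y + N <? N
... | yes E₁<N | _        = inj₁ E₁<N
... | no _     | yes E₂<N = inj₂ E₂<N
... | no E₁≮N  | no E₂≮N  = ⊥-elim (x+2y≡0∧x+2z≡0⇒y*y+z*z+1≢x*x S x y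
  (tie x N≡E₁) (tie y N≡E₂) (trans x*x+y*y+1≡N*S (cong (_* S) (sym S≡N))))
  where
  E E₁ E₂ : ℤ
  E  = S + + 2 * (x + y) + + 2 * N
  E₁ = S + + 2 * x + N
  E₂ = S + + 2 * y + N

  E₁+E₂≡E+S : E₁ + E₂ ≡ E + S
  E₁+E₂≡E+S = regroup S N x y
    where
    regroup : ∀ S N x y → (S + + 2 * x + N) + (S + + 2 * y + N) ≡ (S + + 2 * (x + y) + + 2 * N) + S
    regroup = solve-∀

  N≤E₁ : N ≤ E₁
  N≤E₁ = ≮⇒≥ E₁≮N
  N≤E₂ : N ≤ E₂
  N≤E₂ = ≮⇒≥ E₂≮N
  E₁+E₂≤N+N : E₁ + E₂ ≤ N + N
  E₁+E₂≤N+N = subst (_≤ N + N) (sym E₁+E₂≡E+S) (+-mono-≤ E≤N S≤N)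
  N+N≤E+S : N + N ≤ E + S
  N+N≤E+S = subst (N + N ≤_) E₁+E₂≡E+S (+-mono-≤ N≤E₁ N≤E₂)

  N≡E₁ : N ≡ E₁
  N≡E₁ = +-mono-≤-tightˡ N≤E₁ N≤E₂ E₁+E₂≤N+N
  N≡E₂ : N ≡ E₂
  N≡E₂ = +-mono-≤-tightʳ N≤E₁ N≤E₂ E₁+E₂≤N+N
  S≡N : S ≡ N
  S≡N = +-mono-≤-tightʳ E≤N S≤N N+N≤E+S

  tie : ∀ z → N ≡ S + + 2 * z + N → S + + 2 * z ≡ + 0
  tie z eq = x+y≡y⇒x≡0 (S + + 2 * z) N (sym eq)

conj : 𝔾 → 𝔾
conj (a + b i) = a + (- b) i

dot : 𝔾 → 𝔾 → ℤ
dot z u = re z * re u + im z * im u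

normSq-⊕ : ∀ z u → normSq (z ⊕ u) ≡ normSq z + + 2 * dot z u + normSq u
normSq-⊕ (a + b i) (c + d i) = expand a b c d
  where
  expand : ∀ a b c d → (a + c) * (a + c) + (b + d) * (b + d)
                     ≡ a * a + b * b + + 2 * (a * c + b * d) + (c * c + d * d)
  expand = solve-∀

normSq-⊗ : ∀ z u → normSq (z ⊗ u) ≡ normSq z * normSq u
normSq-⊗ (a + b i) (c + d i) = brahmagupta a b c d
  where
  brahmagupta : ∀ a b c d → (a * c - b * d) * (a * c - b * d) + (a * d + b * c) * (a * d + b * c)
                          ≡ (a * a + b * b) * (c * c + d * d)
  brahmagupta = solve-∀

dot-⊗ : ∀ z t u → dot z (t ⊗ u) ≡ dot (conj u ⊗ z) t
dot-⊗ (a + b i) (m + n i) (c + d i) = adjoint a b m n c d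
  where
  adjoint : ∀ a b m n c d → a * (m * c - n * d) + b * (m * d + n * c)
                          ≡ (c * a - - d * b) * m + (c * b + - d * a) * n
  adjoint = solve-∀

dot-⊕ˡ : ∀ z z′ t → dot (z ⊕ z′) t ≡ dot z t + dot z′ t
dot-⊕ˡ (a + b i) (c + d i) (m + n i) = distrib a b c d m n
  where
  distrib : ∀ a b c d m n → (a + c) * m + (b + d) * n ≡ (a * m + b * n) + (c * m + d * n)
  distrib = solve-∀

lagrange : ∀ α β γ δ → normSq (conj α ⊗ δ ⊕ conj β ⊗ γ) + normSq (α ⊗ γ ⊖ β ⊗ δ)
                     ≡ (normSq α + normSq β) * (normSq δ + normSq γ)
lagrange (a₁ + a₂ i) (b₁ + b₂ i) (c₁ + c₂ i) (d₁ + d₂ i) = expand a₁ a₂ b₁ b₂ c₁ c₂ d₁ d₂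
  where
  expand : ∀ a₁ a₂ b₁ b₂ c₁ c₂ d₁ d₂ →
    let p = (a₁ * d₁ - - a₂ * d₂) + (b₁ * c₁ - - b₂ * c₂)
        q = (a₁ * d₂ + - a₂ * d₁) + (b₁ * c₂ + - b₂ * c₁)
        r = (a₁ * c₁ - a₂ * c₂) - (b₁ * d₁ - b₂ * d₂)
        s = (a₁ * c₂ + a₂ * c₁) - (b₁ * d₂ + b₂ * d₁)
    in  (p * p + q * q) + (r * r + s * s)
      ≡ (a₁ * a₁ + a₂ * a₂ + (b₁ * b₁ + b₂ * b₂)) * (d₁ * d₁ + d₂ * d₂ + (c₁ * c₁ + c₂ * c₂))
  expand = solve-∀

dot-ofℤ : ∀ z m → dot z (ofℤ m) ≡ re z * m
dot-ofℤ z m = trans (cong (_+_ (re z * m)) (*-zeroʳ (im z))) (+-identityʳ (re z * m))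

dot-ofℤi : ∀ z n → dot z (ofℤi n) ≡ im z * n
dot-ofℤi z n = trans (cong (_+ im z * n) (*-zeroʳ (re z))) (+-identityˡ (im z * n))

normSq-ofℤ : ∀ m → normSq (ofℤ m) ≡ m * m
normSq-ofℤ m = +-identityʳ (m * m)

normSq-ofℤi : ∀ n → normSq (ofℤi n) ≡ n * n
normSq-ofℤi n = +-identityˡ (n * n)

module Shift (α β γ δ : 𝔾) where

  N S : ℤ
  N = normSq α + normSq β
  S = normSq δ + normSq γ

  w : 𝔾
  w = conj α ⊗ δ ⊕ conj β ⊗ γ

  energy : 𝔾 → ℤ
  energy t = normSq (δ ⊕ t ⊗ α) + normSq (γ ⊕ t ⊗ β)

  energy-expand : ∀ t → energy t ≡ S + + 2 * dot w t + normSq t * N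
  energy-expand t = begin
    normSq (δ ⊕ t ⊗ α) + normSq (γ ⊕ t ⊗ β)
      ≡⟨ cong₂ _+_ (normSq-⊕ δ (t ⊗ α)) (normSq-⊕ γ (t ⊗ β)) ⟩
    (normSq δ + + 2 * dot δ (t ⊗ α) + normSq (t ⊗ α))
      + (normSq γ + + 2 * dot γ (t ⊗ β) + normSq (t ⊗ β))
      ≡⟨ cong₂ _+_ (cong₂ (λ e f → normSq δ + + 2 * e + f) (dot-⊗ δ t α) (normSq-⊗ t α))
                   (cong₂ (λ e f → normSq γ + + 2 * e + f) (dot-⊗ γ t β) (normSq-⊗ t β)) ⟩
    (normSq δ + + 2 * dot (conj α ⊗ δ) t + normSq t * normSq α)
      + (normSq γ + + 2 * dot (conj β ⊗ γ) t + normSq t * normSq β)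
      ≡⟨ collect (normSq δ) (normSq γ) (dot (conj α ⊗ δ) t) (dot (conj β ⊗ γ) t)
                 (normSq t) (normSq α) (normSq β) ⟩
    S + + 2 * (dot (conj α ⊗ δ) t + dot (conj β ⊗ γ) t) + normSq t * N
      ≡⟨ cong (λ e → S + + 2 * e + normSq t * N) (dot-⊕ˡ (conj α ⊗ δ) (conj β ⊗ γ) t) ⟨
    S + + 2 * dot w t + normSq t * N
      ∎
    where
    collect : ∀ A B X Y T P Q → (A + + 2 * X + T * P) + (B + + 2 * Y + T * Q)
                              ≡ (A + B) + + 2 * (X + Y) + T * (P + Q)
    collect = solve-∀

  energy-unit : ∀ t → normSq t ≡ + 1 → energy t ≡ S + + 2 * dot w t + N
  energy-unit t |t|²≡1 = trans (energy-expand t)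
    (cong (_+_ (S + + 2 * dot w t)) (trans (cong (_* N) |t|²≡1) (*-identityˡ N)))

  energy-ofℤ : ∀ {m} → m * m ≡ + 1 → energy (ofℤ m) ≡ S + + 2 * (re w * m) + N
  energy-ofℤ {m} m*m≡1 = trans (energy-unit (ofℤ m) (trans (normSq-ofℤ m) m*m≡1))
                               (cong (λ e → S + + 2 * e + N) (dot-ofℤ w m))

  energy-ofℤi : ∀ {n} → n * n ≡ + 1 → energy (ofℤi n) ≡ S + + 2 * (im w * n) + N
  energy-ofℤi {n} n*n≡1 = trans (energy-unit (ofℤi n) (trans (normSq-ofℤi n) n*n≡1))
                                (cong (λ e → S + + 2 * e + N) (dot-ofℤi w n))

  lagrange-unimodular : α ⊗ γ ⊖ β ⊗ δ ≡ 𝟙 → ∀ {m n} → m * m ≡ + 1 → n * n ≡ + 1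
    → (re w * m) * (re w * m) + (im w * n) * (im w * n) + + 1 ≡ N * S
  lagrange-unimodular det {m} {n} m*m≡1 n*n≡1 = begin
    (re w * m) * (re w * m) + (im w * n) * (im w * n) + + 1
      ≡⟨ cong₂ (λ a b → a + b + + 1) (*-unit-square (re w) m*m≡1) (*-unit-square (im w) n*n≡1) ⟩
    normSq w + normSq 𝟙                ≡⟨ cong (λ d → normSq w + normSq d) det ⟨
    normSq w + normSq (α ⊗ γ ⊖ β ⊗ δ)  ≡⟨ lagrange α β γ δ ⟩
    N * S                              ∎

lemma1 : (α β γ δ : 𝔾) → Coprime𝔾 α β → α ⊗ γ ⊖ β ⊗ δ ≡ 𝟙
    → normSq γ ≤ normSq β → normSq δ ≤ normSq α
    → (k : 𝔾) → normSq k ≡ + 2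
    → normSq (δ ⊕ k ⊗ α) + normSq (γ ⊕ k ⊗ β) ≤ normSq α + normSq β
    → (normSq (δ ⊕ ofℤ (re k) ⊗ α) + normSq (γ ⊕ ofℤ (re k) ⊗ β) < normSq α + normSq β)
    ⊎ (normSq (δ ⊕ ofℤi (im k) ⊗ α) + normSq (γ ⊕ ofℤi (im k) ⊗ β) < normSq α + normSq β)
lemma1 α β γ δ _ det γ≤β δ≤α (m + n i) |k|²≡2 E≤N =
  Sum.map (subst (_< N) (sym (energy-ofℤ m*m≡1))) (subst (_< N) (sym (energy-ofℤi n*n≡1)))
    (shift-dichotomy (+-mono-≤ δ≤α γ≤β) (lagrange-unimodular det m*m≡1 n*n≡1) E′≤N)
  where
  open Shift α β γ δ
  m*m≡1 : m * m ≡ + 1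
  m*m≡1 = x*x+y*y≡2⇒x*x≡1 m n |k|²≡2
  n*n≡1 : n * n ≡ + 1
  n*n≡1 = x*x+y*y≡2⇒x*x≡1 n m (trans (+-comm (n * n) (m * m)) |k|²≡2)
  E′≤N : S + + 2 * (re w * m + im w * n) + + 2 * N ≤ N
  E′≤N = subst (_≤ N) (trans (energy-expand (m + n i))
                             (cong (λ c → S + + 2 * (re w * m + im w * n) + c * N) |k|²≡2)) E≤N
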